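{- If there exist a generalized Hadamard matrix $GH(g,\lambda)$ over a finite abelian group and $f$ mutually UFS Latin squares of order $g\lambda$, then there exists a linked system of $f+1$ symmetric group divisible designs with parameters $(g^3\lambda^2,g^2\lambda^2,g^2\lambda^2,g,0,g\lambda^2)$ and constants $(\sigma,\tau)=((g+g\lambda-1)\lambda,(g\lambda-1)\lambda)$.
   Context: $I_n,J_n$ denote the identity and all-ones matrices of order $n$; $\otimes$ is the Kronecker product. Let $G$ be an additively written abelian group of order $g$. A generalized Hadamard matrix $GH(g,\lambda)$ over $G$ is a square matrix $H=(h_{ij})$ of order $g\lambda$ with entries in $G$ such that for all distinct rows $i,k$ the multiset $\{h_{ij}-h_{kj}:1\le j\le g\lambda\}$ contains each element of $G$ exactly $\lambda$ times. A $v\times v$ $(0,1)$-matrix $A$ ($v=mn$) is the incidence matrix of a symmetric group divisible design with parameters $(v,k,m,n,\lambda_1,\lambda_2)$ if $AA^\top=A^\top A=kI_v+\lambda_1(I_m\otimes J_n-I_v)+\lambda_2(J_v-I_m\otimes J_n)$. A linked system of $r$ such designs with constants $\sigma,\tau$ is a family of such incidence matrices $A_{i,j}$ ($i\neq j$ in $\{1,\ldots,r\}$) with $A_{i,j}^\top=A_{j,i}$ and $A_{i,j}A_{j,l}=\sigma A_{i,l}+\tau(J_v-A_{i,l})$ for all pairwise distinct $i,j,l$. Two Latin squares $L,L'$ of order $N$ on the same symbol set are UFS if for every row $i$ of $L$ and every row $j$ of $L'$ there is exactly one column $a$ with $L(i,a)=L'(j,a)$; a set of Latin squares is mutually UFS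 if every two distinct members are UFS. -}

module Defs where

open import Data.Nat using (ℕ; zero; suc; _+_; _*_; _∸_)
open import Data.Fin using (Fin; zero; suc; _≟_; quotient)
open import Data.Bool using (Bool; true; false; if_then_else_)
open import Data.Product using (Σ; _×_; _,_)
open import Data.Sum using (_⊎_)
open import Relation.Nullary using (¬_; Dec)
open import Relation.Nullary.Decidable using (⌊_⌋)
open import Relation.Binary.PropositionalEquality using (_≡_; _≢_)
open import Algebra.Structures using (IsAbelianGroup)
open import Function.Definitions using (Injective)

sumFin : ∀ {n} → (Fin n → ℕ) → ℕ
sumFin {zero}  f = 0
sumFin {suc n} f = f zero + sumFin (λ i → f (suc i))

count : ∀ {n} {P : Fin n → Set} → ((x : Fin n) → Dec (P x)) → ℕ
count P? = sumFin (λ x → if ⌊ P? x ⌋ then 1 else 0)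

record FinAbGroup (g : ℕ) : Set where
  field
    _⊕_ : Fin g → Fin g → Fin g
    𝟘   : Fin g
    ⊖_  : Fin g → Fin g
    isAbelianGroup : IsAbelianGroup _≡_ _⊕_ 𝟘 ⊖_

  _⊝_ : Fin g → Fin g → Fin g
  a ⊝ b = a ⊕ (⊖ b)

IsGH : ∀ {g} (G : FinAbGroup g) (λ' : ℕ) → (Fin (g * λ') → Fin (g * λ') → Fin g) → Set
IsGH {g} G λ' H =
  ∀ (i k : Fin (g * λ')) → i ≢ k → ∀ (x : Fin g) →
    count (λ j → (H i j ⊝ H k j) ≟ x) ≡ λ'
  where open FinAbGroup G

record LatinSquare (N : ℕ) : Set where
  field
    L       : Fin N → Fin N → Fin N
    rowInj  : ∀ i → Injective _≡_ _≡_ (L i)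
    colInj  : ∀ a → Injective _≡_ _≡_ (λ i → L i a)

UFS : ∀ {N} → LatinSquare N → LatinSquare N → Set
UFS {N} S S' = ∀ (i j : Fin N) →
  count (λ a → LatinSquare.L S i a ≟ LatinSquare.L S' j a) ≡ 1

MutuallyUFS : ∀ {f N} → (Fin f → LatinSquare N) → Set
MutuallyUFS {f} Ls = ∀ (p q : Fin f) → p ≢ q → UFS (Ls p) (Ls q)

Mat : ℕ → Set
Mat v = Fin v → Fin v → ℕ

transpose : ∀ {v} → Mat v → Mat v
transpose A i j = A j i

_·_ : ∀ {v} → Mat v → Mat v → Mat v
(A · B) i j = sumFin (λ t → A i t * B t j)

IsZeroOne : ∀ {v} → Mat v → Set
IsZeroOne A = ∀ i j → (A i j ≡ 0) ⊎ (A i j ≡ 1)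

-- Entries of k I_v + λ₁ (I_m ⊗ J_n - I_v) + λ₂ (J_v - I_m ⊗ J_n), v = m * n,
-- where index i ∈ Fin (m * n) lies in block  quotient n i  (i = block * n + r).
gddRHS : ∀ (m n k λ₁ λ₂ : ℕ) → Mat (m * n)
gddRHS m n k λ₁ λ₂ i j =
  if ⌊ i ≟ j ⌋ then k
  else (if ⌊ quotient {m} n i ≟ quotient {m} n j ⌋ then λ₁ else λ₂)

-- Incidence matrix of a symmetric GDD with parameters (m n, k, m, n, λ₁, λ₂)
IsSGDD : ∀ (m n k λ₁ λ₂ : ℕ) → Mat (m * n) → Set
IsSGDD m n k λ₁ λ₂ A =
  IsZeroOne A ×
  (∀ i j → (A · transpose A) i j ≡ gddRHS m n k λ₁ λ₂ i j) ×
  (∀ i j → (transpose A · A) i j ≡ gddRHS m n k λ₁ λ₂ i j)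

-- Linked system of r SGDDs with constants σ, τ (only the matrices A i j, i ≠ j, matter)
IsLinkedSystem : ∀ (r m n k λ₁ λ₂ σ τ : ℕ) → (Fin r → Fin r → Mat (m * n)) → Set
IsLinkedSystem r m n k λ₁ λ₂ σ τ A =
  (∀ i j → i ≢ j → IsSGDD m n k λ₁ λ₂ (A i j)) ×
  (∀ i j → i ≢ j → ∀ x y → transpose (A i j) x y ≡ A j i x y) ×
  (∀ i j l → i ≢ j → j ≢ l → i ≢ l → ∀ x y →
     (A i j · A j l) x y ≡ σ * A i l x y + τ * (1 ∸ A i l x y))

-- Every matrix of the system is the expansion of an M × M matrix φ over G (M = (gλ)²): points are
-- pairs (p, r) ∈ Fin M × G and an entry x of φ becomes the permutation matrix of r ↦ r + x.  A product
-- of two expansions counts, at ((p, r), (s, r′)), the q with φ(p, q) + ψ(q, s) = r′ − r, so the design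
-- and linking conditions become counting statements about φ.
--
-- Index p by pairs (a, x) of indices of H and, for a Latin square K of order gλ, let the (a, b) block
-- of φ[K] be the difference matrix (x, y) ↦ H(K a b, y) − H(K a b, x).  In the count for φ[K₁], φ[K₂]
-- the block b contributes gλ·[H(k, w) − H(k, x) = z] with k = K₁ a b if K₁ a b = K₂ b c, and λ otherwise
-- since H is a GH matrix.  Taking K₂ to be the transpose of K₁ shows that φ[K] is again generalized
-- Hadamard in rows and columns, so its expansion is a symmetric GDD; this uses that the transpose of a
-- GH matrix is one, which follows by double counting coincidences of differences together with the
-- equality case of Σ c² ≥ (Σ c)² / g.  Finally, from f mutually UFS squares one builds squares K i j
-- (i ≠ j) such that row a of K i j and column c of K j k agree in exactly one place, where they equal
-- K i k a c; that single block turns the count into gλ·[…] + (gλ − 1)λ, which gives σ and τ.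

module Submission where

open import Defs
open import Algebra.Bundles using (AbelianGroup)
open import Algebra.Structures using (IsAbelianGroup)
import Algebra.Properties.AbelianGroup as AbelianGroupProperties
import Algebra.Solver.CommutativeMonoid as CommutativeMonoidSolver
open import Data.Bool using (if_then_else_)
open import Data.Fin
  using (Fin; zero; suc; _≟_; _↑ˡ_; _↑ʳ_; combine; remQuot; quotient; remainder; cast; punchOut)
open import Data.Fin.Permutation using (permutation)
open import Data.Fin.Properties
  using (any?; nonZeroIndex; combine-remQuot; remQuot-combine; cast-involutive; cast-is-id;
         punchOut-injective; injective⇒≤)
open import Data.Nat using (ℕ; zero; suc; _+_; _*_; _∸_; _≤_; z≤n; ∣_-_∣; >-nonZero⁻¹)
open import Data.Nat.Properties hiding (_≟_)
open import Algebra.Properties.CommutativeSemigroup +-commutativeSemigroup using (x∙yz≈y∙xz)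
open import Algebra.Properties.Semiring.Sum +-*-semiring
  using (sum; ∑-comm; ∑-distrib-+; ∑-permute; *-distribˡ-sum)
open import Data.Nat.Solver using (module +-*-Solver)
open import Data.Product using (Σ; ∃; _×_; _,_; proj₁; proj₂; uncurry)
open import Data.Sum using (_⊎_; inj₁; inj₂; [_,_]′)
open import Function using (_∘_; flip; id)
open import Function.Definitions using (Injective)
open import Level using (0ℓ)
open import Relation.Binary.PropositionalEquality
open import Relation.Nullary using (¬_; Dec; yes; no; contradiction)
open import Relation.Nullary.Decidable using (⌊_⌋)

private
  variable
    X Y : Set
    m n : ℕ

𝟙 : Dec X → ℕ
𝟙 d = if ⌊ d ⌋ then 1 else 0

if-yes : (d : Dec X) {u v : Y} → X → (if ⌊ d ⌋ then u else v) ≡ u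
if-yes (yes _) _ = refl
if-yes (no ¬a) a = contradiction a ¬a

if-no : (d : Dec X) {u v : Y} → ¬ X → (if ⌊ d ⌋ then u else v) ≡ v
if-no (yes a) ¬a = contradiction a ¬a
if-no (no _)  _  = refl

𝟙-cong : (d : Dec X) (e : Dec Y) → (X → Y) → (Y → X) → 𝟙 d ≡ 𝟙 e
𝟙-cong (yes a) e f _ = sym (if-yes e (f a))
𝟙-cong (no ¬a) e _ g = sym (if-no e (¬a ∘ g))

𝟙-0∨1 : (d : Dec X) → 𝟙 d ≡ 0 ⊎ 𝟙 d ≡ 1
𝟙-0∨1 (yes _) = inj₂ refl
𝟙-0∨1 (no _)  = inj₁ refl

injective⇒surjective : {π : Fin n → Fin n} → Injective _≡_ _≡_ π → ∀ k → ∃ λ i → π i ≡ k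
injective⇒surjective {suc n} {π} π-inj k with any? (λ i → π i ≟ k)
... | yes hit  = hit
... | no  miss = contradiction (injective⇒≤ punched-injective) 1+n≰n
  where
  punched : Fin (suc n) → Fin n
  punched i = punchOut (λ k≡πi → miss (i , sym k≡πi))
  punched-injective : Injective _≡_ _≡_ punched
  punched-injective = π-inj ∘ punchOut-injective {i = k} _ _

sumFin≡sum : (f : Fin n → ℕ) → sumFin f ≡ sum f
sumFin≡sum {zero}  f = refl
sumFin≡sum {suc n} f = cong (f zero +_) (sumFin≡sum (f ∘ suc))

sumFin-cong : {f h : Fin n → ℕ} → (∀ i → f i ≡ h i) → sumFin f ≡ sumFin h
sumFin-cong {zero}  _   = refl
sumFin-cong {suc n} f≗h = cong₂ _+_ (f≗h zero) (sumFin-cong (f≗h ∘ suc))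

sumFin-const : ∀ c → sumFin {n} (λ _ → c) ≡ n * c
sumFin-const {zero}  c = refl
sumFin-const {suc n} c = cong (c +_) (sumFin-const {n} c)

sumFin-+ : (f h : Fin n → ℕ) → sumFin (λ i → f i + h i) ≡ sumFin f + sumFin h
sumFin-+ f h = begin
  sumFin (λ i → f i + h i)  ≡⟨ sumFin≡sum (λ i → f i + h i) ⟩
  sum (λ i → f i + h i)     ≡⟨ ∑-distrib-+ f h ⟩
  sum f + sum h             ≡⟨ sym (cong₂ _+_ (sumFin≡sum f) (sumFin≡sum h)) ⟩
  sumFin f + sumFin h       ∎
  where open ≡-Reasoning

sumFin-*ˡ : ∀ c (f : Fin n → ℕ) → sumFin (λ i → c * f i) ≡ c * sumFin f
sumFin-*ˡ c f = begin
  sumFin (λ i → c * f i)  ≡⟨ sumFin≡sum (λ i → c * f i) ⟩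
  sum (λ i → c * f i)     ≡⟨ sym (*-distribˡ-sum c f) ⟩
  c * sum f               ≡⟨ cong (c *_) (sym (sumFin≡sum f)) ⟩
  c * sumFin f            ∎
  where open ≡-Reasoning

sumFin-*ʳ : ∀ c (f : Fin n → ℕ) → sumFin (λ i → f i * c) ≡ sumFin f * c
sumFin-*ʳ c f = trans (sumFin-cong (λ i → *-comm (f i) c)) (trans (sumFin-*ˡ c f) (*-comm c _))

sumFin-comm : (f : Fin m → Fin n → ℕ) →
  sumFin (λ i → sumFin (f i)) ≡ sumFin (λ j → sumFin (λ i → f i j))
sumFin-comm f = begin
  sumFin (λ i → sumFin (f i))             ≡⟨ sumFin-cong (λ i → sumFin≡sum (f i)) ⟩
  sumFin (λ i → sum (f i))                ≡⟨ sumFin≡sum (λ i → sum (f i)) ⟩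
  sum (λ i → sum (f i))                   ≡⟨ ∑-comm f ⟩
  sum (λ j → sum (λ i → f i j))           ≡⟨ sym (sumFin≡sum (λ j → sum (λ i → f i j))) ⟩
  sumFin (λ j → sum (λ i → f i j))        ≡⟨ sumFin-cong (λ j → sym (sumFin≡sum (λ i → f i j))) ⟩
  sumFin (λ j → sumFin (λ i → f i j))     ∎
  where open ≡-Reasoning

sumFin-comm² : ∀ {k l} (F : Fin m → Fin n → Fin k → Fin l → ℕ) →
  sumFin (λ a → sumFin (λ b → sumFin (λ c → sumFin (F a b c)))) ≡
  sumFin (λ c → sumFin (λ d → sumFin (λ a → sumFin (λ b → F a b c d))))
sumFin-comm² F = begin
  sumFin (λ a → sumFin (λ b → sumFin (λ c → sumFin (F a b c))))
    ≡⟨ sumFin-cong (λ a → sumFin-comm (λ b c → sumFin (F a b c))) ⟩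
  sumFin (λ a → sumFin (λ c → sumFin (λ b → sumFin (F a b c))))
    ≡⟨ sumFin-comm (λ a c → sumFin (λ b → sumFin (F a b c))) ⟩
  sumFin (λ c → sumFin (λ a → sumFin (λ b → sumFin (F a b c))))
    ≡⟨ sumFin-cong (λ c → sumFin-cong (λ a → sumFin-comm (λ b d → F a b c d))) ⟩
  sumFin (λ c → sumFin (λ a → sumFin (λ d → sumFin (λ b → F a b c d))))
    ≡⟨ sumFin-cong (λ c → sumFin-comm (λ a d → sumFin (λ b → F a b c d))) ⟩
  sumFin (λ c → sumFin (λ d → sumFin (λ a → sumFin (λ b → F a b c d)))) ∎
  where open ≡-Reasoning

sumFin-permute : (f : Fin n → ℕ) {π : Fin n → Fin n} → Injective _≡_ _≡_ π →
  sumFin (f ∘ π) ≡ sumFin f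
sumFin-permute {n} f {π} π-inj = begin
  sumFin (f ∘ π)  ≡⟨ sumFin≡sum (f ∘ π) ⟩
  sum (f ∘ π)     ≡⟨ sym (∑-permute f (permutation π π⁻¹ π∘π⁻¹ π⁻¹∘π)) ⟩
  sum f           ≡⟨ sym (sumFin≡sum f) ⟩
  sumFin f        ∎
  where
  open ≡-Reasoning
  π⁻¹ : Fin n → Fin n
  π⁻¹ k = proj₁ (injective⇒surjective π-inj k)
  π∘π⁻¹ : ∀ k → π (π⁻¹ k) ≡ k
  π∘π⁻¹ k = proj₂ (injective⇒surjective π-inj k)
  π⁻¹∘π : ∀ i → π⁻¹ (π i) ≡ i
  π⁻¹∘π i = π-inj (π∘π⁻¹ (π i))

sumFin-mono : {f h : Fin n → ℕ} → (∀ i → f i ≤ h i) → sumFin f ≤ sumFin h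
sumFin-mono {zero}  _   = z≤n
sumFin-mono {suc n} f≤h = +-mono-≤ (f≤h zero) (sumFin-mono (f≤h ∘ suc))

sumFin-mono-≡⇒≡ : {f h : Fin n → ℕ} → (∀ i → f i ≤ h i) → sumFin f ≡ sumFin h → ∀ i → f i ≡ h i
sumFin-mono-≡⇒≡ {suc n} {f} {h} f≤h Σf≡Σh = go
  where
  head≡ : f zero ≡ h zero
  head≡ = ≤-antisym (f≤h zero) (+-cancelʳ-≤ (sumFin (f ∘ suc)) _ _ (begin
    h zero + sumFin (f ∘ suc)  ≤⟨ +-monoʳ-≤ (h zero) (sumFin-mono (f≤h ∘ suc)) ⟩
    h zero + sumFin (h ∘ suc)  ≡⟨ sym Σf≡Σh ⟩
    f zero + sumFin (f ∘ suc)  ∎))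
    where open ≤-Reasoning
  go : ∀ i → f i ≡ h i
  go zero    = head≡
  go (suc i) = sumFin-mono-≡⇒≡ (f≤h ∘ suc)
    (+-cancelˡ-≡ (f zero) _ _ (trans Σf≡Σh (cong (_+ _) (sym head≡)))) i

suc≟suc : (x y : Fin n) → ⌊ suc x ≟ suc y ⌋ ≡ ⌊ x ≟ y ⌋
suc≟suc x y with x ≟ y
... | yes _ = refl
... | no  _ = refl

sumFin-𝟙≟ : (x : Fin n) (F : Fin n → ℕ) → sumFin (λ k → 𝟙 (x ≟ k) * F k) ≡ F x
sumFin-𝟙≟ {suc n} zero    F = begin
  F zero + 0 + sumFin {n} (λ _ → 0)  ≡⟨ cong (F zero + 0 +_) (trans (sumFin-const {n} 0) (*-zeroʳ n)) ⟩
  F zero + 0 + 0                     ≡⟨ trans (+-identityʳ _) (+-identityʳ _) ⟩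
  F zero                             ∎
  where open ≡-Reasoning
sumFin-𝟙≟ {suc n} (suc x) F = trans
  (sumFin-cong (λ k → cong (λ b → (if b then 1 else 0) * F (suc k)) (suc≟suc x k)))
  (sumFin-𝟙≟ x (F ∘ suc))

sumFin-single : (b₀ : Fin n) (u c : ℕ) →
  sumFin (λ b → if ⌊ b ≟ b₀ ⌋ then u else c) ≡ u + (n ∸ 1) * c
sumFin-single {suc n}       zero     u c = cong (u +_) (sumFin-const {n} c)
sumFin-single {suc (suc n)} (suc b₀) u c = begin
  c + sumFin (λ b → if ⌊ suc b ≟ suc b₀ ⌋ then u else c)
    ≡⟨ cong (c +_) (sumFin-cong (λ b → cong (if_then u else c) (suc≟suc b b₀))) ⟩
  c + sumFin (λ b → if ⌊ b ≟ b₀ ⌋ then u else c)  ≡⟨ cong (c +_) (sumFin-single b₀ u c) ⟩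
  c + (u + n * c)                                 ≡⟨ x∙yz≈y∙xz c u (n * c) ⟩
  u + (c + n * c)                                 ∎
  where open ≡-Reasoning

sumFin-split : (F : Fin (m + n) → ℕ) →
  sumFin F ≡ sumFin (λ i → F (i ↑ˡ n)) + sumFin (λ i → F (m ↑ʳ i))
sumFin-split {zero}      F = refl
sumFin-split {suc m} {n} F =
  trans (cong (F zero +_) (sumFin-split {m} (F ∘ suc))) (sym (+-assoc (F zero) _ _))

sumFin-combine : (F : Fin (m * n) → ℕ) →
  sumFin F ≡ sumFin (λ a → sumFin (λ x → F (combine {m} {n} a x)))
sumFin-combine {zero}      F = refl
sumFin-combine {suc m} {n} F = trans (sumFin-split {n} {m * n} F)
  (cong (sumFin (λ x → F (x ↑ˡ (m * n))) +_) (sumFin-combine {m} (λ i → F (n ↑ʳ i))))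

sumFin-cast : (e : m ≡ n) (f : Fin m → ℕ) → sumFin f ≡ sumFin (f ∘ cast (sym e))
sumFin-cast refl f = sumFin-cong (λ i → cong f (sym (cast-is-id refl i)))

module _ {P : Fin n → Set} (P? : ∀ x → Dec (P x)) where

  count-all : (∀ x → P x) → count P? ≡ n
  count-all all = trans (sumFin-cong (λ x → if-yes (P? x) (all x)))
                        (trans (sumFin-const {n} 1) (*-identityʳ n))

  count-none : (∀ x → ¬ P x) → count P? ≡ 0
  count-none none = trans (sumFin-cong (λ x → if-no (P? x) (none x)))
                          (trans (sumFin-const {n} 0) (*-zeroʳ n))

count-≗ : ∀ {k} {d d′ : Fin n → Fin k} → (∀ q → d q ≡ d′ q) → ∀ z →
  count (λ q → d q ≟ z) ≡ count (λ q → d′ q ≟ z)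
count-≗ d≗d′ z = sumFin-cong (λ q → cong (λ x → 𝟙 (x ≟ z)) (d≗d′ q))

count≡0⇒∄ : {P : Fin n → Set} (P? : ∀ x → Dec (P x)) → count P? ≡ 0 → ∀ x → ¬ P x
count≡0⇒∄ {suc n} P? c≡0 x p with P? zero
count≡0⇒∄ {suc n} P? ()  x       p | yes _
count≡0⇒∄ {suc n} P? c≡0 zero    p | no ¬p = ¬p p
count≡0⇒∄ {suc n} P? c≡0 (suc x) p | no ¬p = count≡0⇒∄ (P? ∘ suc) c≡0 x p

count≡1⇒∃! : {P : Fin n → Set} (P? : ∀ x → Dec (P x)) → count P? ≡ 1 →
  Σ (Fin n) λ x → P x × (∀ y → P y → y ≡ x)
count≡1⇒∃! {suc n} {P} P? c≡1 with P? zero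
... | yes p = zero , p , only-zero
  where
  only-zero : ∀ y → P y → y ≡ zero
  only-zero zero    _ = refl
  only-zero (suc y) q = contradiction q (count≡0⇒∄ (P? ∘ suc) (suc-injective c≡1) y)
... | no ¬p with count≡1⇒∃! (P? ∘ suc) c≡1
...   | x , px , unique = suc x , px , λ { zero q → contradiction q ¬p ; (suc y) q → cong suc (unique y q) }

2ab+∣a-b∣²≡a²+b² : ∀ a b → a * b + a * b + ∣ a - b ∣ * ∣ a - b ∣ ≡ a * a + b * b
2ab+∣a-b∣²≡a²+b² zero    b       = refl
2ab+∣a-b∣²≡a²+b² (suc a) zero    = trans (cong (λ x → x + x + suc a * suc a) (*-zeroʳ (suc a)))
                                      (sym (+-identityʳ (suc a * suc a)))
2ab+∣a-b∣²≡a²+b² (suc a) (suc b) = begin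
  suc a * suc b + suc a * suc b + d * d
    ≡⟨ solve 3 (λ a b d → (con 1 :+ a) :* (con 1 :+ b) :+ (con 1 :+ a) :* (con 1 :+ b) :+ d :* d
                          := (a :* b :+ a :* b :+ d :* d) :+ (con 2 :+ a :+ a :+ b :+ b)) refl a b d ⟩
  (a * b + a * b + d * d) + (2 + a + a + b + b)
    ≡⟨ cong (_+ (2 + a + a + b + b)) (2ab+∣a-b∣²≡a²+b² a b) ⟩
  (a * a + b * b) + (2 + a + a + b + b)
    ≡⟨ solve 2 (λ a b → (a :* a :+ b :* b) :+ (con 2 :+ a :+ a :+ b :+ b)
                      := (con 1 :+ a) :* (con 1 :+ a) :+ (con 1 :+ b) :* (con 1 :+ b)) refl a b ⟩
  suc a * suc a + suc b * suc b ∎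
  where
  open ≡-Reasoning
  open +-*-Solver
  d = ∣ a - b ∣

2ab≤a²+b² : ∀ a b → a * b + a * b ≤ a * a + b * b
2ab≤a²+b² a b = subst (a * b + a * b ≤_) (2ab+∣a-b∣²≡a²+b² a b) (m≤m+n _ _)

2ab≡a²+b²⇒a≡b : ∀ a b → a * b + a * b ≡ a * a + b * b → a ≡ b
2ab≡a²+b²⇒a≡b a b eq = ∣m-n∣≡0⇒m≡n ([ id , id ]′ (m*n≡0⇒m≡0∨n≡0 _ d²≡0))
  where
  d²≡0 : ∣ a - b ∣ * ∣ a - b ∣ ≡ 0
  d²≡0 = +-cancelˡ-≡ _ _ _ (trans (2ab+∣a-b∣²≡a²+b² a b) (trans (sym eq) (sym (+-identityʳ _))))

module _ (c : Fin n → ℕ) (l : ℕ) (Σc≡nl : sumFin c ≡ n * l) where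

  private
    Σc² = sumFin (λ z → c z * c z)

    Σ2cl : sumFin (λ z → c z * l + c z * l) ≡ n * l * l + n * l * l
    Σ2cl = trans (sumFin-+ (λ z → c z * l) (λ z → c z * l)) (cong₂ _+_ Σcl Σcl)
      where Σcl = trans (sumFin-*ʳ l c) (cong (_* l) Σc≡nl)

    Σc²+l² : sumFin (λ z → c z * c z + l * l) ≡ Σc² + n * l * l
    Σc²+l² = trans (sumFin-+ (λ z → c z * c z) (λ _ → l * l))
                   (cong (Σc² +_) (trans (sumFin-const {n} (l * l)) (sym (*-assoc n l l))))

    2cl≤c²+l² : ∀ z → c z * l + c z * l ≤ c z * c z + l * l
    2cl≤c²+l² z = 2ab≤a²+b² (c z) l

  sumFin²-≥ : n * l * l ≤ sumFin (λ z → c z * c z)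
  sumFin²-≥ = +-cancelʳ-≤ _ _ _ (subst₂ _≤_ Σ2cl Σc²+l² (sumFin-mono 2cl≤c²+l²))

  sumFin²-≡⇒≡ : sumFin (λ z → c z * c z) ≡ n * l * l → ∀ z → c z ≡ l
  sumFin²-≡⇒≡ eq z = 2ab≡a²+b²⇒a≡b (c z) l (sumFin-mono-≡⇒≡ 2cl≤c²+l²
    (trans Σ2cl (trans (cong (_+ n * l * l) (sym eq)) (sym Σc²+l²))) z)

module FinAbGroupProperties {g} (G : FinAbGroup g) where

  open FinAbGroup G public
  open IsAbelianGroup isAbelianGroup public
    using (assoc; comm; identityʳ; inverseˡ; inverseʳ)

  abelianGroup : AbelianGroup 0ℓ 0ℓ
  abelianGroup = record { _∙_ = _⊕_ ; ε = 𝟘 ; _⁻¹ = ⊖_ ; isAbelianGroup = isAbelianGroup }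

  open AbelianGroupProperties abelianGroup using (x≈z//y; //-rightDividesˡ; x∙y⁻¹≈ε⇒x≈y)
  open AbelianGroupProperties abelianGroup public using () renaming (⁻¹-anti-homo‿- to ⊖-⊝)
  open CommutativeMonoidSolver (AbelianGroup.commutativeMonoid abelianGroup)
    using (solve; _⊜_)
    renaming (_⊕_ to _:⊕_)

  ⊕≡⇒≡⊝ : ∀ {x y z} → x ⊕ y ≡ z → x ≡ z ⊝ y
  ⊕≡⇒≡⊝ = x≈z//y _ _ _

  ≡⊝⇒⊕≡ : ∀ {x y z} → x ≡ z ⊝ y → x ⊕ y ≡ z
  ≡⊝⇒⊕≡ {y = y} {z} refl = //-rightDividesˡ y z

  ⊝≡𝟘⇒≡ : ∀ {x y} → x ⊝ y ≡ 𝟘 → x ≡ y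
  ⊝≡𝟘⇒≡ = x∙y⁻¹≈ε⇒x≈y _ _

  ⊕ˡ≡⇒≡⊝ : ∀ {x a y} → x ⊕ a ≡ y → a ≡ y ⊝ x
  ⊕ˡ≡⇒≡⊝ {x} {a} e = ⊕≡⇒≡⊝ (trans (comm a x) e)

  ≡⊝⇒⊕ˡ≡ : ∀ {x a y} → a ≡ y ⊝ x → x ⊕ a ≡ y
  ≡⊝⇒⊕ˡ≡ {x} {a} e = trans (comm x a) (≡⊝⇒⊕≡ e)

  ⊝-interchange : ∀ a b c d → (a ⊝ b) ⊕ (c ⊝ d) ≡ (a ⊝ d) ⊕ (c ⊝ b)
  ⊝-interchange a b c d = solve 4 (λ a b′ c d′ → (a :⊕ b′) :⊕ (c :⊕ d′) ⊜ (a :⊕ d′) :⊕ (c :⊕ b′))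
    refl a (⊖ b) c (⊖ d)

  ⊝-telescope : ∀ a b c → (a ⊝ b) ⊕ (c ⊝ a) ≡ c ⊝ b
  ⊝-telescope a b c = begin
    (a ⊝ b) ⊕ (c ⊝ a)  ≡⟨ solve 4 (λ a b′ c a′ → (a :⊕ b′) :⊕ (c :⊕ a′) ⊜ (c :⊕ b′) :⊕ (a :⊕ a′))
                            refl a (⊖ b) c (⊖ a) ⟩
    (c ⊝ b) ⊕ (a ⊝ a)  ≡⟨ cong ((c ⊝ b) ⊕_) (inverseʳ a) ⟩
    (c ⊝ b) ⊕ 𝟘        ≡⟨ identityʳ (c ⊝ b) ⟩
    c ⊝ b              ∎
    where open ≡-Reasoning

  ⊝-swap : ∀ {a b c d} → a ⊝ b ≡ c ⊝ d → a ⊝ c ≡ b ⊝ d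
  ⊝-swap {a} {b} {c} {d} eq = begin
    a ⊝ c              ≡⟨ sym (⊝-telescope b c a) ⟩
    (b ⊝ c) ⊕ (a ⊝ b)  ≡⟨ cong ((b ⊝ c) ⊕_) eq ⟩
    (b ⊝ c) ⊕ (c ⊝ d)  ≡⟨ comm (b ⊝ c) (c ⊝ d) ⟩
    (c ⊝ d) ⊕ (b ⊝ c)  ≡⟨ ⊝-telescope c d b ⟩
    b ⊝ d              ∎
    where open ≡-Reasoning

coincidences : ∀ {g} → (Fin n → Fin g) → ℕ
coincidences d = sumFin (λ i → sumFin (λ i′ → 𝟙 (d i′ ≟ d i)))

module _ {g} (d : Fin n → Fin g) where

  private
    fibre : Fin g → ℕ
    fibre z = count (λ i → d i ≟ z)

  sumFin-fibre : sumFin fibre ≡ n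
  sumFin-fibre = begin
    sumFin (λ z → sumFin (λ i → 𝟙 (d i ≟ z)))  ≡⟨ sumFin-comm (λ z i → 𝟙 (d i ≟ z)) ⟩
    sumFin (λ i → sumFin (λ z → 𝟙 (d i ≟ z)))  ≡⟨ sumFin-cong (λ i → trans (sumFin-cong (λ z → sym (*-identityʳ (𝟙 (d i ≟ z)))))
                                                                      (sumFin-𝟙≟ (d i) (λ _ → 1))) ⟩
    sumFin {n} (λ _ → 1)                       ≡⟨ trans (sumFin-const {n} 1) (*-identityʳ n) ⟩
    n                                          ∎
    where open ≡-Reasoning

  sumFin-fibre² : sumFin (λ z → fibre z * fibre z) ≡ coincidences d
  sumFin-fibre² = begin
    sumFin (λ z → fibre z * fibre z)
      ≡⟨ sumFin-cong (λ z → sym (sumFin-*ʳ (fibre z) (λ i → 𝟙 (d i ≟ z)))) ⟩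
    sumFin (λ z → sumFin (λ i → 𝟙 (d i ≟ z) * fibre z))
      ≡⟨ sumFin-cong (λ z → sumFin-cong (λ i → sym (sumFin-*ˡ (𝟙 (d i ≟ z)) (λ i′ → 𝟙 (d i′ ≟ z))))) ⟩
    sumFin (λ z → sumFin (λ i → sumFin (λ i′ → 𝟙 (d i ≟ z) * 𝟙 (d i′ ≟ z))))
      ≡⟨ sumFin-comm (λ z i → sumFin (λ i′ → 𝟙 (d i ≟ z) * 𝟙 (d i′ ≟ z))) ⟩
    sumFin (λ i → sumFin (λ z → sumFin (λ i′ → 𝟙 (d i ≟ z) * 𝟙 (d i′ ≟ z))))
      ≡⟨ sumFin-cong (λ i → sumFin-comm (λ z i′ → 𝟙 (d i ≟ z) * 𝟙 (d i′ ≟ z))) ⟩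
    sumFin (λ i → sumFin (λ i′ → sumFin (λ z → 𝟙 (d i ≟ z) * 𝟙 (d i′ ≟ z))))
      ≡⟨ sumFin-cong (λ i → sumFin-cong (λ i′ → sumFin-𝟙≟ (d i) (λ z → 𝟙 (d i′ ≟ z)))) ⟩
    coincidences d ∎
    where open ≡-Reasoning

  coincidences-const : ∀ {x} → (∀ i → d i ≡ x) → coincidences d ≡ n * n
  coincidences-const d≡x = begin
    coincidences d            ≡⟨ sumFin-cong (λ i → sumFin-cong (λ i′ → if-yes (d i′ ≟ d i) (trans (d≡x i′) (sym (d≡x i))))) ⟩
    sumFin {n} (λ _ → sumFin {n} (λ _ → 1))  ≡⟨ sumFin-cong {n} (λ _ → trans (sumFin-const {n} 1) (*-identityʳ n)) ⟩
    sumFin {n} (λ _ → n)      ≡⟨ sumFin-const {n} n ⟩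
    n * n                     ∎
    where open ≡-Reasoning

RowBalanced : ∀ {g} → FinAbGroup g → ℕ → (Fin m → Fin m → Fin g) → Set
RowBalanced G μ φ = ∀ p s → p ≢ s → ∀ z → count (λ q → (φ p q ⊝ φ s q) ≟ z) ≡ μ
  where open FinAbGroup G

module _ {g λ'} (G : FinAbGroup g) {H : Fin (g * λ') → Fin (g * λ') → Fin g} (isGH : IsGH G λ' H) where

  open FinAbGroupProperties G

  private
    N = g * λ'

    rowCoincidences colCoincidences expected : Fin N → Fin N → ℕ
    rowCoincidences i k  = coincidences (λ j → H i j ⊝ H k j)
    colCoincidences j j′ = coincidences (λ i → H i j ⊝ H i j′)
    expected a b = if ⌊ a ≟ b ⌋ then N * N else g * λ' * λ'

    rowCoincidences≡expected : ∀ i k → rowCoincidences i k ≡ expected i k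
    rowCoincidences≡expected i k with i ≟ k
    ... | yes refl = coincidences-const _ (λ j → inverseʳ (H i j))
    ... | no  i≢k  = begin
      rowCoincidences i k                                    ≡⟨ sym (sumFin-fibre² d) ⟩
      sumFin (λ z → count (λ j → d j ≟ z) * count (λ j → d j ≟ z))  ≡⟨ sumFin-cong (λ z → cong₂ _*_ (isGH i k i≢k z) (isGH i k i≢k z)) ⟩
      sumFin {g} (λ _ → λ' * λ')                             ≡⟨ sumFin-const {g} (λ' * λ') ⟩
      g * (λ' * λ')                                          ≡⟨ sym (*-assoc g λ' λ') ⟩
      g * λ' * λ'                                            ∎
      where
      open ≡-Reasoning
      d = λ j → H i j ⊝ H k j

    expected≤colCoincidences : ∀ j j′ → expected j j′ ≤ colCoincidences j j′
    expected≤colCoincidences j j′ with j ≟ j′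
    ... | yes refl = ≤-reflexive (sym (coincidences-const _ (λ i → inverseʳ (H i j))))
    ... | no  _    = subst (g * λ' * λ' ≤_) (sumFin-fibre² d)
                       (sumFin²-≥ (λ z → count (λ i → d i ≟ z)) λ' (sumFin-fibre d))
      where d = λ i → H i j ⊝ H i j′

    colCoincidence⇔rowCoincidence : ∀ j j′ i i′ →
      𝟙 ((H i′ j ⊝ H i′ j′) ≟ (H i j ⊝ H i j′)) ≡ 𝟙 ((H i′ j′ ⊝ H i j′) ≟ (H i′ j ⊝ H i j))
    colCoincidence⇔rowCoincidence j j′ i i′ = 𝟙-cong (_ ≟ _) (_ ≟ _) (sym ∘ ⊝-swap) (⊝-swap ∘ sym)

    double-counting : sumFin (λ j → sumFin (colCoincidences j)) ≡ sumFin (λ i → sumFin (rowCoincidences i))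
    double-counting = begin
      sumFin (λ j → sumFin (λ j′ → sumFin (λ i → sumFin (λ i′ → 𝟙 ((H i′ j ⊝ H i′ j′) ≟ (H i j ⊝ H i j′))))))
        ≡⟨ sumFin-cong (λ j → sumFin-cong (λ j′ → sumFin-cong (λ i → sumFin-cong (colCoincidence⇔rowCoincidence j j′ i)))) ⟩
      sumFin (λ j → sumFin (λ j′ → sumFin (λ i → sumFin (λ i′ → 𝟙 ((H i′ j′ ⊝ H i j′) ≟ (H i′ j ⊝ H i j)))))) 
        ≡⟨ sumFin-cong (λ j → sumFin-cong (λ j′ → sumFin-comm (λ i i′ → 𝟙 ((H i′ j′ ⊝ H i j′) ≟ (H i′ j ⊝ H i j))))) ⟩
      sumFin (λ j → sumFin (λ j′ → sumFin (λ i′ → sumFin (λ i → 𝟙 ((H i′ j′ ⊝ H i j′) ≟ (H i′ j ⊝ H i j))))))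
        ≡⟨ sumFin-comm² (λ j j′ i′ i → 𝟙 ((H i′ j′ ⊝ H i j′) ≟ (H i′ j ⊝ H i j))) ⟩
      sumFin (λ i′ → sumFin (λ i → sumFin (λ j → sumFin (λ j′ → 𝟙 ((H i′ j′ ⊝ H i j′) ≟ (H i′ j ⊝ H i j)))))) ∎
      where open ≡-Reasoning

    colCoincidences≡expected : ∀ j j′ → colCoincidences j j′ ≡ expected j j′
    colCoincidences≡expected j = sym ∘ sumFin-mono-≡⇒≡ (expected≤colCoincidences j)
      (sumFin-mono-≡⇒≡ (λ j → sumFin-mono (expected≤colCoincidences j)) totals j)
      where
      totals : sumFin (λ j → sumFin (expected j)) ≡ sumFin (λ j → sumFin (colCoincidences j))
      totals = sym (trans double-counting (sumFin-cong (λ i → sumFin-cong (rowCoincidences≡expected i))))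

  IsGH-flip : IsGH G λ' (flip H)
  IsGH-flip j j′ j≢j′ = sumFin²-≡⇒≡ (λ z → count (λ i → d i ≟ z)) λ' (sumFin-fibre d)
    (trans (sumFin-fibre² d) (trans (colCoincidences≡expected j j′) (if-no (j ≟ j′) j≢j′)))
    where d = λ i → H i j ⊝ H i j′

·-cong : {A A′ B B′ : Mat n} → (∀ i j → A i j ≡ A′ i j) → (∀ i j → B i j ≡ B′ i j) →
  ∀ i j → (A · B) i j ≡ (A′ · B′) i j
·-cong A≗A′ B≗B′ i j = sumFin-cong (λ t → cong₂ _*_ (A≗A′ i t) (B≗B′ t j))

module Expansion {g} (G : FinAbGroup g) (m : ℕ) where

  open FinAbGroupProperties G

  block : Fin (m * g) → Fin m
  block = quotient g

  offset : Fin (m * g) → Fin g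
  offset = remainder {m} g

  block-offset-injective : ∀ {i j} → block i ≡ block j → offset i ≡ offset j → i ≡ j
  block-offset-injective {i} {j} b≡ o≡ =
    trans (sym (combine-remQuot {m} g i)) (trans (cong₂ combine b≡ o≡) (combine-remQuot {m} g j))

  expand : (Fin m → Fin m → Fin g) → Mat (m * g)
  expand φ i j = 𝟙 (offset i ⊕ φ (block i) (block j) ≟ offset j)

  expand-cong : ∀ {φ ψ} → (∀ p q → φ p q ≡ ψ p q) → ∀ i j → expand φ i j ≡ expand ψ i j
  expand-cong φ≗ψ i j = cong (λ x → 𝟙 (offset i ⊕ x ≟ offset j)) (φ≗ψ (block i) (block j))

  expand-isZeroOne : ∀ φ → IsZeroOne (expand φ)
  expand-isZeroOne φ i j = 𝟙-0∨1 _

  transpose-expand : ∀ φ i j → transpose (expand φ) i j ≡ expand (λ p q → ⊖ φ q p) i j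
  transpose-expand φ i j = 𝟙-cong (_ ≟ _) (_ ≟ _) (sym ∘ ⊕≡⇒≡⊝) (≡⊝⇒⊕≡ ∘ sym)

  expand-· : ∀ φ ψ i j →
    (expand φ · expand ψ) i j ≡ count (λ q → (φ (block i) q ⊕ ψ q (block j)) ≟ (offset j ⊝ offset i))
  expand-· φ ψ i j = begin
    sumFin (λ t → expand φ i t * expand ψ t j)
      ≡⟨ sumFin-combine {m} (λ t → expand φ i t * expand ψ t j) ⟩
    sumFin (λ q → sumFin (λ r → expand φ i (combine {m} q r) * expand ψ (combine q r) j))
      ≡⟨ sumFin-cong (λ q → sumFin-cong (λ r → cong (λ (q , r) → 𝟙 (oᵢ ⊕ φ bᵢ q ≟ r) * 𝟙 (r ⊕ ψ q bⱼ ≟ oⱼ))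
                                                     (remQuot-combine {m} {g} q r))) ⟩
    sumFin (λ q → sumFin (λ r → 𝟙 (oᵢ ⊕ φ bᵢ q ≟ r) * 𝟙 (r ⊕ ψ q bⱼ ≟ oⱼ)))
      ≡⟨ sumFin-cong (λ q → sumFin-𝟙≟ (oᵢ ⊕ φ bᵢ q) (λ r → 𝟙 (r ⊕ ψ q bⱼ ≟ oⱼ))) ⟩
    count (λ q → (oᵢ ⊕ φ bᵢ q) ⊕ ψ q bⱼ ≟ oⱼ)
      ≡⟨ sumFin-cong (λ q → 𝟙-cong (_ ≟ oⱼ) ((φ bᵢ q ⊕ ψ q bⱼ) ≟ _)
                                  (λ e → ⊕ˡ≡⇒≡⊝ (trans (sym (assoc _ _ _)) e))
                                  (λ e → trans (assoc _ _ _) (≡⊝⇒⊕ˡ≡ e))) ⟩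
    count (λ q → (φ bᵢ q ⊕ ψ q bⱼ) ≟ (oⱼ ⊝ oᵢ)) ∎
    where
    open ≡-Reasoning
    bᵢ = block i
    bⱼ = block j
    oᵢ = offset i
    oⱼ = offset j

  count≡gddRHS : ∀ (κ : Fin m → Fin m → Fin m → Fin g) μ → (∀ p q → κ p p q ≡ 𝟘) →
    (∀ p s → p ≢ s → ∀ z → count (λ q → κ p s q ≟ z) ≡ μ) →
    ∀ i j → count (λ q → κ (block i) (block j) q ≟ (offset j ⊝ offset i)) ≡ gddRHS m g m 0 μ i j
  count≡gddRHS κ μ κ-diag κ-balanced i j with block i ≟ block j
  ... | no  bᵢ≢bⱼ = trans (κ-balanced _ _ bᵢ≢bⱼ _) (sym (if-no (i ≟ j) (bᵢ≢bⱼ ∘ cong block)))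
  ... | yes bᵢ≡bⱼ with i ≟ j
  ...   | yes refl = count-all _ (λ q → trans (κ-diag (block i) q) (sym (inverseʳ (offset i))))
  ...   | no  i≢j  = count-none _ (λ q κ≡ → i≢j (block-offset-injective bᵢ≡bⱼ (sym (⊝≡𝟘⇒≡
                       (trans (sym κ≡) (trans (cong (λ b → κ (block i) b q) (sym bᵢ≡bⱼ)) (κ-diag _ q)))))))

  expand-isSGDD : ∀ {μ} φ → RowBalanced G μ φ → RowBalanced G μ (flip φ) → IsSGDD m g m 0 μ (expand φ)
  expand-isSGDD {μ} φ rows cols = expand-isZeroOne φ , gram , cogram
    where
    φ⁻ᵀ : Fin m → Fin m → Fin g
    φ⁻ᵀ p q = ⊖ φ q p

    gram : ∀ i j → (expand φ · transpose (expand φ)) i j ≡ gddRHS m g m 0 μ i j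
    gram i j = trans (·-cong {A = expand φ} {A′ = expand φ} (λ _ _ → refl) (transpose-expand φ) i j)
      (trans (expand-· φ φ⁻ᵀ i j) (count≡gddRHS (λ p s q → φ p q ⊝ φ s q) μ (λ p q → inverseʳ (φ p q)) rows i j))

    cogram : ∀ i j → (transpose (expand φ) · expand φ) i j ≡ gddRHS m g m 0 μ i j
    cogram i j = trans (·-cong {B = expand φ} {B′ = expand φ} (transpose-expand φ) (λ _ _ → refl) i j)
      (trans (expand-· φ⁻ᵀ φ i j) (count≡gddRHS (λ p s q → φ⁻ᵀ p q ⊕ φ q s) μ (λ p q → inverseˡ (φ q p)) balanced i j))
      where
      balanced : ∀ p s → p ≢ s → ∀ z → count (λ q → (φ⁻ᵀ p q ⊕ φ q s) ≟ z) ≡ μ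
      balanced p s p≢s z = trans (count-≗ (λ q → comm (φ⁻ᵀ p q) (φ q s)) z) (cols s p (p≢s ∘ sym) z)

  expand-linked : ∀ {σ τ} φ ψ χ →
    (∀ p s z → count (λ q → (φ p q ⊕ ψ q s) ≟ z) ≡ σ * 𝟙 (χ p s ≟ z) + τ * (1 ∸ 𝟙 (χ p s ≟ z))) →
    ∀ i j → (expand φ · expand ψ) i j ≡ σ * expand χ i j + τ * (1 ∸ expand χ i j)
  expand-linked {σ} {τ} φ ψ χ linked i j = trans (expand-· φ ψ i j) (trans (linked _ _ _)
    (cong (λ t → σ * t + τ * (1 ∸ t)) (𝟙-cong (_ ≟ _) (_ ≟ _) ≡⊝⇒⊕ˡ≡ ⊕ˡ≡⇒≡⊝)))

Square : ℕ → Set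
Square n = Fin n → Fin n → Fin n

IsLatin : Square n → Set
IsLatin K = (∀ a → Injective _≡_ _≡_ (K a)) × (∀ b → Injective _≡_ _≡_ (λ a → K a b))

flip-isLatin : {K : Square n} → IsLatin K → IsLatin (flip K)
flip-isLatin (rows , cols) = cols , rows

Linked : (K₁ K₂ K₃ : Square n) → Set
Linked {n} K₁ K₂ K₃ = ∀ a c → Σ (Fin n) λ b₀ →
  (∀ b → K₁ a b ≡ K₂ b c → b ≡ b₀) × K₁ a b₀ ≡ K₂ b₀ c × K₁ a b₀ ≡ K₃ a c

module UFSFamily {f n} (Ls : Fin f → LatinSquare n) (mufs : MutuallyUFS Ls) where

  L : Fin f → Square n
  L p = LatinSquare.L (Ls p)

  rowInj : ∀ p a → Injective _≡_ _≡_ (L p a)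
  rowInj p = LatinSquare.rowInj (Ls p)

  colInj : ∀ p b → Injective _≡_ _≡_ (λ a → L p a b)
  colInj p = LatinSquare.colInj (Ls p)

  column-surjective : ∀ p b v → ∃ λ a → L p a b ≡ v
  column-surjective p b = injective⇒surjective (colInj p b)

  private
    meet-∃! : ∀ {p q} → p ≢ q → ∀ a b → Σ (Fin n) λ d → L p a d ≡ L q b d × (∀ d′ → L p a d′ ≡ L q b d′ → d′ ≡ d)
    meet-∃! {p} {q} p≢q a b = count≡1⇒∃! (λ d → L p a d ≟ L q b d) (mufs p q p≢q a b)

  -- The value for p = q is junk.
  meet : Fin f → Fin f → Fin n → Fin n → Fin n
  meet p q a b with p ≟ q
  ... | yes _   = a
  ... | no  p≢q = proj₁ (meet-∃! p≢q a b)

  meet-agrees : ∀ {p q} → p ≢ q → ∀ a b → L p a (meet p q a b) ≡ L q b (meet p q a b)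
  meet-agrees {p} {q} p≢q a b with p ≟ q
  ... | yes p≡q = contradiction p≡q p≢q
  ... | no  p≢q = proj₁ (proj₂ (meet-∃! p≢q a b))

  meet-unique : ∀ {p q} → p ≢ q → ∀ {a b d} → L p a d ≡ L q b d → meet p q a b ≡ d
  meet-unique {p} {q} p≢q {a} {b} {d} agree with p ≟ q
  ... | yes p≡q = contradiction p≡q p≢q
  ... | no  p≢q = sym (proj₂ (proj₂ (meet-∃! p≢q a b)) d agree)

  -- K (1+p) (1+q) a b is the common value of row a of L p and row b of L q;
  -- the diagonal squares K i i are junk.
  K : Fin (suc f) → Fin (suc f) → Square n
  K zero    zero    a b = a
  K zero    (suc q) a b = L q b a
  K (suc p) zero    a b = L p a b
  K (suc p) (suc q) a b = L p a (meet p q a b)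

  private
    suc≢ : ∀ {p q : Fin f} → Fin.suc p ≢ suc q → p ≢ q
    suc≢ ne = ne ∘ cong suc

  K-isLatin : ∀ i j → i ≢ j → IsLatin (K i j)
  K-isLatin zero    zero    i≢j = contradiction refl i≢j
  K-isLatin zero    (suc q) _   = colInj q , rowInj q
  K-isLatin (suc p) zero    _   = rowInj p , colInj p
  K-isLatin (suc p) (suc q) i≢j = rows , cols
    where
    p≢q = suc≢ i≢j
    rows : ∀ a → Injective _≡_ _≡_ (K (suc p) (suc q) a)
    rows a {b} {b′} eq = colInj q (meet p q a b) (begin
      L q b  (meet p q a b)   ≡⟨ sym (meet-agrees p≢q a b) ⟩
      L p a  (meet p q a b)   ≡⟨ eq ⟩
      L p a  (meet p q a b′)  ≡⟨ meet-agrees p≢q a b′ ⟩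
      L q b′ (meet p q a b′)  ≡⟨ cong (L q b′) (sym (rowInj p a eq)) ⟩
      L q b′ (meet p q a b)   ∎)
      where open ≡-Reasoning
    cols : ∀ b → Injective _≡_ _≡_ (λ a → K (suc p) (suc q) a b)
    cols b {a} {a′} eq = colInj p (meet p q a b) (trans eq (cong (L p a′) (sym same-meet)))
      where
      same-meet : meet p q a b ≡ meet p q a′ b
      same-meet = rowInj q b (trans (sym (meet-agrees p≢q a b)) (trans eq (meet-agrees p≢q a′ b)))

  K-flip : ∀ i j → i ≢ j → ∀ a b → K j i a b ≡ K i j b a
  K-flip zero    zero    i≢j = contradiction refl i≢j
  K-flip zero    (suc q) _   a b = refl
  K-flip (suc p) zero    _   a b = refl
  K-flip (suc p) (suc q) i≢j a b = trans (meet-agrees q≢p a b)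
    (cong (L p b) (sym (meet-unique p≢q (sym (meet-agrees q≢p a b)))))
    where
    p≢q = suc≢ i≢j
    q≢p = p≢q ∘ sym

  private
    linked-sss : ∀ {p q r} → p ≢ q → q ≢ r → p ≢ r → Linked (K (suc p) (suc q)) (K (suc q) (suc r)) (K (suc p) (suc r))
    linked-sss {p} {q} {r} p≢q q≢r p≢r a c = b₀ , unique , agree , common
      where
      d₀ = meet p r a c
      b₀ = proj₁ (column-surjective q d₀ (L p a d₀))
      Lq-b₀ : L q b₀ d₀ ≡ L p a d₀
      Lq-b₀ = proj₂ (column-surjective q d₀ (L p a d₀))
      common : L p a (meet p q a b₀) ≡ L p a d₀
      common = cong (L p a) (meet-unique p≢q (sym Lq-b₀))
      agree : L p a (meet p q a b₀) ≡ L q b₀ (meet q r b₀ c)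
      agree = trans common (trans (sym Lq-b₀) (cong (L q b₀) (sym (meet-unique q≢r (trans Lq-b₀ (meet-agrees p≢r a c))))))
      unique : ∀ b → L p a (meet p q a b) ≡ L q b (meet q r b c) → b ≡ b₀
      unique b eq = colInj q d₀ (begin
        L q b d₀  ≡⟨ cong (L q b) (sym d≡d₀) ⟩
        L q b d   ≡⟨ sym (meet-agrees p≢q a b) ⟩
        L p a d   ≡⟨ cong (L p a) d≡d₀ ⟩
        L p a d₀  ≡⟨ sym Lq-b₀ ⟩
        L q b₀ d₀ ∎)
        where
        open ≡-Reasoning
        d = meet p q a b
        d≡e : d ≡ meet q r b c
        d≡e = rowInj q b (trans (sym (meet-agrees p≢q a b)) eq)
        d≡d₀ : d ≡ d₀
        d≡d₀ = sym (meet-unique p≢r (trans eq (trans (meet-agrees q≢r b c) (cong (L r c) (sym d≡e)))))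

    linked-0ss : ∀ {q r} → q ≢ r → Linked (K zero (suc q)) (K (suc q) (suc r)) (K zero (suc r))
    linked-0ss {q} {r} q≢r a c = b₀ , unique , agree , Lq-b₀
      where
      b₀ = proj₁ (column-surjective q a (L r c a))
      Lq-b₀ : L q b₀ a ≡ L r c a
      Lq-b₀ = proj₂ (column-surjective q a (L r c a))
      agree : L q b₀ a ≡ L q b₀ (meet q r b₀ c)
      agree = cong (L q b₀) (sym (meet-unique q≢r Lq-b₀))
      unique : ∀ b → L q b a ≡ L q b (meet q r b c) → b ≡ b₀
      unique b eq = colInj q a (trans eq (trans (meet-agrees q≢r b c)
                      (trans (cong (L r c) (sym (rowInj q b eq))) (sym Lq-b₀))))

    linked-s0s : ∀ {p r} → p ≢ r → Linked (K (suc p) zero) (K zero (suc r)) (K (suc p) (suc r))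
    linked-s0s p≢r a c = _ , (λ b eq → sym (meet-unique p≢r eq)) , meet-agrees p≢r a c , refl

    linked-ss0 : ∀ {p q} → p ≢ q → Linked (K (suc p) (suc q)) (K (suc q) zero) (K (suc p) zero)
    linked-ss0 {p} {q} p≢q a c = b₀ , unique , trans common (sym Lq-b₀) , common
      where
      b₀ = proj₁ (column-surjective q c (L p a c))
      Lq-b₀ : L q b₀ c ≡ L p a c
      Lq-b₀ = proj₂ (column-surjective q c (L p a c))
      common : L p a (meet p q a b₀) ≡ L p a c
      common = cong (L p a) (meet-unique p≢q (sym Lq-b₀))
      unique : ∀ b → L p a (meet p q a b) ≡ L q b c → b ≡ b₀
      unique b eq = colInj q c (trans (sym eq) (trans (cong (L p a) meet≡c) (sym Lq-b₀)))
        where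
        meet≡c : meet p q a b ≡ c
        meet≡c = rowInj q b (trans (sym (meet-agrees p≢q a b)) eq)

  K-linked : ∀ i j k → i ≢ j → j ≢ k → i ≢ k → Linked (K i j) (K j k) (K i k)
  K-linked zero    zero    _       i≢j _   _   = contradiction refl i≢j
  K-linked zero    (suc q) zero    _   _   i≢k = contradiction refl i≢k
  K-linked (suc p) zero    zero    _   j≢k _   = contradiction refl j≢k
  K-linked zero    (suc q) (suc r) _   j≢k _   = linked-0ss (suc≢ j≢k)
  K-linked (suc p) zero    (suc r) _   _   i≢k = linked-s0s (suc≢ i≢k)
  K-linked (suc p) (suc q) zero    i≢j _   _   = linked-ss0 (suc≢ i≢j)
  K-linked (suc p) (suc q) (suc r) i≢j j≢k i≢k = linked-sss (suc≢ i≢j) (suc≢ j≢k) (suc≢ i≢k)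

linked-constants : ∀ g l {I} → 1 ≤ g * l → I ≡ 0 ⊎ I ≡ 1 →
  g * l * I + (g * l ∸ 1) * l ≡ (g + g * l ∸ 1) * l * I + (g * l ∸ 1) * l * (1 ∸ I)
linked-constants g l {I} _ (inj₁ refl) = begin
  g * l * 0 + τ   ≡⟨ cong (_+ τ) (*-zeroʳ (g * l)) ⟩
  τ               ≡⟨ sym (*-identityʳ τ) ⟩
  τ * 1           ≡⟨ cong (_+ τ * 1) (sym (*-zeroʳ σ)) ⟩
  σ * 0 + τ * 1   ∎
  where
  open ≡-Reasoning
  σ = (g + g * l ∸ 1) * l
  τ = (g * l ∸ 1) * l
linked-constants g l {I} 1≤gl (inj₂ refl) = begin
  g * l * 1 + τ            ≡⟨ cong (_+ τ) (*-identityʳ (g * l)) ⟩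
  g * l + (g * l ∸ 1) * l  ≡⟨ sym (*-distribʳ-+ l g (g * l ∸ 1)) ⟩
  (g + (g * l ∸ 1)) * l    ≡⟨ cong (_* l) (sym (+-∸-assoc g 1≤gl)) ⟩
  σ                        ≡⟨ sym (trans (cong (σ * 1 +_) (*-zeroʳ τ)) (trans (+-identityʳ _) (*-identityʳ σ))) ⟩
  σ * 1 + τ * 0            ∎
  where
  open ≡-Reasoning
  σ = (g + g * l ∸ 1) * l
  τ = (g * l ∸ 1) * l

module BlockConstruction {g λ'} (G : FinAbGroup g) {H : Fin (g * λ') → Fin (g * λ') → Fin g}
                         (isGH : IsGH G λ' H) where

  open FinAbGroupProperties G

  N M σ τ : ℕ
  N = g * λ'
  M = g * g * λ' * λ'
  σ = (g + g * λ' ∸ 1) * λ'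
  τ = (g * λ' ∸ 1) * λ'

  private
    M≡N*N : M ≡ N * N
    M≡N*N = solve 2 (λ g l → g :* g :* l :* l := (g :* l) :* (g :* l)) refl g λ'
      where open +-*-Solver

  pair : Fin N → Fin N → Fin M
  pair a x = cast (sym M≡N*N) (combine a x)

  unpair : Fin M → Fin N × Fin N
  unpair p = remQuot {N} N (cast M≡N*N p)

  unpair-pair : ∀ a x → unpair (pair a x) ≡ (a , x)
  unpair-pair a x = trans (cong (remQuot N) (cast-involutive M≡N*N (sym M≡N*N) (combine a x))) (remQuot-combine a x)

  pair-unpair : ∀ p → uncurry pair (unpair p) ≡ p
  pair-unpair p = trans (cong (cast (sym M≡N*N)) (combine-remQuot {N} N (cast M≡N*N p)))
                        (cast-involutive (sym M≡N*N) M≡N*N p)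

  unpair-injective : ∀ {p s} → unpair p ≡ unpair s → p ≡ s
  unpair-injective {p} {s} eq = trans (sym (pair-unpair p)) (trans (cong (uncurry pair) eq) (pair-unpair s))

  sumFin-pair : (F : Fin M → ℕ) → sumFin F ≡ sumFin (λ b → sumFin (λ y → F (pair b y)))
  sumFin-pair F = trans (sumFin-cast M≡N*N F) (sumFin-combine {N} (F ∘ cast (sym M≡N*N)))

  rowDiff : Fin N → Fin N → Fin N → Fin g
  rowDiff k x y = H k y ⊝ H k x

  φ[_] : Square N → Fin M → Fin M → Fin g
  φ[ K ] p q = rowDiff (K a b) x y
    where
    a = proj₁ (unpair p)
    x = proj₂ (unpair p)
    b = proj₁ (unpair q)
    y = proj₂ (unpair q)

  count-rowDiff-⊕ : ∀ k₁ k₂ x w z →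
    count (λ y → (rowDiff k₁ x y ⊕ rowDiff k₂ y w) ≟ z) ≡
    (if ⌊ k₁ ≟ k₂ ⌋ then N * 𝟙 (rowDiff k₁ x w ≟ z) else λ')
  count-rowDiff-⊕ k₁ k₂ x w z with k₁ ≟ k₂
  ... | yes refl  = trans (count-≗ (λ y → ⊝-telescope (H k₁ y) (H k₁ x) (H k₁ w)) z) (sumFin-const {N} _)
  ... | no  k₁≢k₂ = trans (sumFin-cong (λ y → 𝟙-cong (_ ≟ z) ((H k₁ y ⊝ H k₂ y) ≟ (z ⊝ (H k₂ w ⊝ H k₁ x)))
                            (λ e → ⊕≡⇒≡⊝ (trans (sym (⊝-interchange _ _ _ _)) e))
                            (λ e → trans (⊝-interchange _ _ _ _) (≡⊝⇒⊕≡ e))))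
                          (isGH k₁ k₂ k₁≢k₂ _)

  blockSum : Square N → Square N → Fin N × Fin N → Fin N × Fin N → Fin g → ℕ
  blockSum K₁ K₂ (a , x) (c , w) z =
    sumFin (λ b → if ⌊ K₁ a b ≟ K₂ b c ⌋ then N * 𝟙 (rowDiff (K₁ a b) x w ≟ z) else λ')

  count-φ⊕φ : ∀ K₁ K₂ p s z →
    count (λ q → (φ[ K₁ ] p q ⊕ φ[ K₂ ] q s) ≟ z) ≡ blockSum K₁ K₂ (unpair p) (unpair s) z
  count-φ⊕φ K₁ K₂ p s z = trans (sumFin-pair _) (sumFin-cong (λ b → trans
    (count-≗ (λ y → cong (λ (b , y) → rowDiff (K₁ a b) x y ⊕ rowDiff (K₂ b c) y w) (unpair-pair b y)) z)
    (count-rowDiff-⊕ (K₁ a b) (K₂ b c) x w z)))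
    where
    a = proj₁ (unpair p)
    x = proj₂ (unpair p)
    c = proj₁ (unpair s)
    w = proj₂ (unpair s)

  blockSum-latin : ∀ K → IsLatin K → ∀ {u v} → u ≢ v → ∀ z → blockSum K (flip K) u v z ≡ g * λ' * λ'
  blockSum-latin K (rows , cols) {a , x} {c , w} u≢v z with a ≟ c
  ... | no  a≢c  = trans (sumFin-cong (λ b → if-no (K a b ≟ K c b) (a≢c ∘ cols b))) (sumFin-const {N} λ')
  ... | yes refl = begin
    sumFin (λ b → if ⌊ K a b ≟ K a b ⌋ then N * 𝟙 (rowDiff (K a b) x w ≟ z) else λ')
      ≡⟨ sumFin-cong (λ b → if-yes (K a b ≟ K a b) refl) ⟩
    sumFin (λ b → N * 𝟙 (rowDiff (K a b) x w ≟ z))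
      ≡⟨ sumFin-*ˡ N (λ b → 𝟙 (rowDiff (K a b) x w ≟ z)) ⟩
    N * count (λ b → rowDiff (K a b) x w ≟ z)
      ≡⟨ cong (N *_) (sumFin-permute (λ k → 𝟙 (rowDiff k x w ≟ z)) (rows a)) ⟩
    N * count (λ k → rowDiff k x w ≟ z)
      ≡⟨ cong (N *_) (IsGH-flip G isGH w x (u≢v ∘ cong (a ,_) ∘ sym) z) ⟩
    N * λ' ∎
    where open ≡-Reasoning

  blockSum-linked : ∀ {K₁ K₂ K₃} → Linked K₁ K₂ K₃ → ∀ a x c w z →
    blockSum K₁ K₂ (a , x) (c , w) z ≡ σ * 𝟙 (rowDiff (K₃ a c) x w ≟ z) + τ * (1 ∸ 𝟙 (rowDiff (K₃ a c) x w ≟ z))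
  blockSum-linked {K₁} {K₂} {K₃} linked a x c w z = begin
    blockSum K₁ K₂ (a , x) (c , w) z
      ≡⟨ sumFin-cong only-b₀ ⟩
    sumFin (λ b → if ⌊ b ≟ b₀ ⌋ then N * 𝟙 (rowDiff (K₃ a c) x w ≟ z) else λ')
      ≡⟨ sumFin-single b₀ _ λ' ⟩
    N * 𝟙 (rowDiff (K₃ a c) x w ≟ z) + τ
      ≡⟨ linked-constants g λ' (>-nonZero⁻¹ N ⦃ nonZeroIndex b₀ ⦄) (𝟙-0∨1 (rowDiff (K₃ a c) x w ≟ z)) ⟩
    σ * 𝟙 (rowDiff (K₃ a c) x w ≟ z) + τ * (1 ∸ 𝟙 (rowDiff (K₃ a c) x w ≟ z)) ∎
    where
    open ≡-Reasoning
    b₀ = proj₁ (linked a c)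
    only-b₀ : ∀ b → (if ⌊ K₁ a b ≟ K₂ b c ⌋ then N * 𝟙 (rowDiff (K₁ a b) x w ≟ z) else λ')
                  ≡ (if ⌊ b ≟ b₀ ⌋ then N * 𝟙 (rowDiff (K₃ a c) x w ≟ z) else λ')
    only-b₀ b with b ≟ b₀
    ... | yes refl = let (_ , agree , common) = proj₂ (linked a c) in
                     trans (if-yes (K₁ a b ≟ K₂ b c) agree) (cong (λ k → N * 𝟙 (rowDiff k x w ≟ z)) common)
    ... | no  b≢b₀ = if-no (K₁ a b ≟ K₂ b c) (b≢b₀ ∘ proj₁ (proj₂ (linked a c)) b)

  φ-rowBalanced : ∀ {K} → IsLatin K → RowBalanced G (g * λ' * λ') φ[ K ]
  φ-rowBalanced {K} latin p s p≢s z =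
    trans (count-≗ (λ q → cong (φ[ K ] p q ⊕_) (⊖-⊝ (H _ _) (H _ _))) z)
          (trans (count-φ⊕φ K (flip K) p s z) (blockSum-latin K latin (p≢s ∘ unpair-injective) z))

  φ-colBalanced : ∀ {K} → IsLatin K → RowBalanced G (g * λ' * λ') (flip φ[ K ])
  φ-colBalanced {K} latin p s p≢s z =
    trans (count-≗ (λ q → trans (comm _ _) (cong (_⊕ φ[ K ] q p) (⊖-⊝ (H _ _) (H _ _)))) z)
          (trans (count-φ⊕φ (flip K) K s p z)
                 (blockSum-latin (flip K) (flip-isLatin latin) (p≢s ∘ sym ∘ unpair-injective) z))

  φ-linked : ∀ {K₁ K₂ K₃} → Linked K₁ K₂ K₃ → ∀ p s z →
    count (λ q → (φ[ K₁ ] p q ⊕ φ[ K₂ ] q s) ≟ z) ≡ σ * 𝟙 (φ[ K₃ ] p s ≟ z) + τ * (1 ∸ 𝟙 (φ[ K₃ ] p s ≟ z))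
  φ-linked {K₁} {K₂} linked p s z = trans (count-φ⊕φ K₁ K₂ p s z)
    (blockSum-linked linked (proj₁ (unpair p)) (proj₂ (unpair p)) (proj₁ (unpair s)) (proj₂ (unpair s)) z)

  φ-flip : ∀ {K K′} → (∀ a b → K′ a b ≡ K b a) → ∀ p q → ⊖ φ[ K ] q p ≡ φ[ K′ ] p q
  φ-flip {K} K′≡Kᵀ p q = trans (⊖-⊝ (H k _) (H k _)) (cong (λ k → rowDiff k x y) (sym (K′≡Kᵀ _ _)))
    where
    k = K (proj₁ (unpair q)) (proj₁ (unpair p))
    x = proj₂ (unpair p)
    y = proj₂ (unpair q)

theorem5p7 : ∀ (g λ' f : ℕ) (G : FinAbGroup g) →
    Σ (Fin (g * λ') → Fin (g * λ') → Fin g) (IsGH G λ') →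
    Σ (Fin f → LatinSquare (g * λ')) MutuallyUFS →
    Σ (Fin (suc f) → Fin (suc f) → Mat ((g * g * λ' * λ') * g))
      (IsLinkedSystem (suc f) (g * g * λ' * λ') g (g * g * λ' * λ') 0 (g * λ' * λ')
        ((g + g * λ' ∸ 1) * λ') ((g * λ' ∸ 1) * λ'))
theorem5p7 g λ' f G (H , isGH) (Ls , mufs) = A , isSGDD , transpose-A , linked
  where
  open BlockConstruction G isGH
  open Expansion G M
  open UFSFamily Ls mufs

  A : Fin (suc f) → Fin (suc f) → Mat (M * g)
  A i j = expand φ[ K i j ]

  isSGDD : ∀ i j → i ≢ j → IsSGDD M g M 0 (g * λ' * λ') (A i j)
  isSGDD i j i≢j = expand-isSGDD φ[ K i j ] (φ-rowBalanced (K-isLatin i j i≢j)) (φ-colBalanced (K-isLatin i j i≢j))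

  transpose-A : ∀ i j → i ≢ j → ∀ x y → transpose (A i j) x y ≡ A j i x y
  transpose-A i j i≢j x y = trans (transpose-expand φ[ K i j ] x y)
    (expand-cong (φ-flip (K-flip i j i≢j)) x y)

  linked : ∀ i j k → i ≢ j → j ≢ k → i ≢ k → ∀ x y → (A i j · A j k) x y ≡ σ * A i k x y + τ * (1 ∸ A i k x y)
  linked i j k i≢j j≢k i≢k = expand-linked {σ} {τ} φ[ K i j ] φ[ K j k ] φ[ K i k ] (φ-linked (K-linked i j k i≢j j≢k i≢k))
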